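{- If a finite DAG $G$ has the strong $k$-$\mathrm{lca}$-property, then it has the strict $k$-$\mathrm{lca}$-property.
   Context: For a finite DAG $G$, write $v\preceq w$ if there is a directed path (possibly of length $0$) from $w$ to $v$; the leaf set $X$ is the set of $\preceq$-minimal vertices; $\mathrm{C}(v)=\{x\in X\mid x\preceq v\}$. $X^{(k)}$ is the set of non-empty subsets of $X$ of size at most $k$. A least common ancestor of $Y\subseteq V(G)$ is a $\preceq$-minimal element of the set of common ancestors of all elements of $Y$; $\mathrm{lca}(Y)$ is defined (and equals $q$) if $q$ is the only such vertex. $G$ has the $\mathrm{lca}$-property if $\mathrm{lca}(A)$ is defined for every non-empty $A\subseteq X$; the $k$-$\mathrm{lca}$-property if $\mathrm{lca}(A)$ is defined for all $A\in X^{(k)}$. $G$ has the strong $k$-$\mathrm{lca}$-property if it has the $\mathrm{lca}$-property and for every non-empty $A\subseteq X$ there is $U\in X^{(k)}$ with $\mathrm{lca}(U)=\mathrm{lca}(A)$. $G$ has the strict $k$-$\mathrm{lca}$-property if it has the $k$-$\mathrm{lca}$-property, $\mathrm{lca}(\mathrm{C}(v))$ is defined for every $v\in V(G)$, and for every $w\in V(G)$ there is $U\in X^{(k)}$ with $\mathrm{lca}(\mathrm{C}(w))=\mathrm{lca}(U)$. -}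

module Defs where

open import Data.Nat using (ℕ; _≤_)
open import Data.Fin using (Fin)
open import Data.Fin.Subset using (Subset; _∈_; ∣_∣)
open import Data.Bool using (Bool; true)
open import Data.Product using (Σ; ∃; _×_)
open import Relation.Binary.PropositionalEquality using (_≡_)
open import Relation.Binary.Construct.Closure.ReflexiveTransitive using (Star)
open import Relation.Nullary using (¬_)

Digraph : ℕ → Set
Digraph n = Fin n → Fin n → Bool

module _ {n : ℕ} (G : Digraph n) where

  Arc : Fin n → Fin n → Set
  Arc u v = G u v ≡ true

  _⪯_ : Fin n → Fin n → Set
  v ⪯ w = Star Arc w v

  IsDAG : Set
  IsDAG = ∀ u v → Arc u v → ¬ (u ⪯ v)

  IsLeaf : Fin n → Set
  IsLeaf x = ∀ v → v ⪯ x → v ≡ x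

  CommonAncestor : (Fin n → Set) → Fin n → Set
  CommonAncestor Y q = ∀ y → Y y → y ⪯ q

  IsLCA : (Fin n → Set) → Fin n → Set
  IsLCA Y q = CommonAncestor Y q × (∀ q' → CommonAncestor Y q' → q' ⪯ q → q' ≡ q)

  LcaIs : (Fin n → Set) → Fin n → Set
  LcaIs Y q = IsLCA Y q × (∀ q' → IsLCA Y q' → q' ≡ q)

  LcaDefined : (Fin n → Set) → Set
  LcaDefined Y = ∃ λ q → LcaIs Y q

  ⟦_⟧ : Subset n → Fin n → Set
  ⟦ A ⟧ x = x ∈ A

  NonEmptyLeafSet : Subset n → Set
  NonEmptyLeafSet A = (∃ λ x → x ∈ A) × (∀ x → x ∈ A → IsLeaf x)

  InXk : ℕ → Subset n → Set
  InXk k A = NonEmptyLeafSet A × ∣ A ∣ ≤ k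

  C : Fin n → Fin n → Set
  C v x = IsLeaf x × x ⪯ v

  LcaProperty : Set
  LcaProperty = ∀ A → NonEmptyLeafSet A → LcaDefined ⟦ A ⟧

  KLcaProperty : ℕ → Set
  KLcaProperty k = ∀ A → InXk k A → LcaDefined ⟦ A ⟧

  StrongKLcaProperty : ℕ → Set
  StrongKLcaProperty k =
    LcaProperty ×
    (∀ A → NonEmptyLeafSet A →
       Σ (Subset n) λ U → InXk k U × (∃ λ q → LcaIs ⟦ U ⟧ q × LcaIs ⟦ A ⟧ q))

  StrictKLcaProperty : ℕ → Set
  StrictKLcaProperty k =
    KLcaProperty k ×
    (∀ v → LcaDefined (C v)) ×
    (∀ w → Σ (Subset n) λ U → InXk k U × (∃ λ q → LcaIs (C w) q × LcaIs ⟦ U ⟧ q))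

-- For every vertex w, C(w) is itself a non-empty leaf set: following arcs
-- from w cannot go on forever in a finite DAG, so it ends in a leaf below w.
-- The strong k-lca-property applied to A = C(w) then gives both that
-- lca(C(w)) is defined and a U ∈ X^(k) with lca(U) = lca(C(w)). The only
-- constructive work is to present C(w) as a finite Subset, i.e. to decide
-- leafhood and reachability, which we do by searching paths of length < n.
module Submission where

open import Defs
open import Data.Nat using (ℕ; zero; suc; _≤_; _<_; s≤s)
open import Data.Nat.Properties using (<⇒≤; <-irrefl)
open import Data.Fin using (Fin; zero; suc; _≟_)
open import Data.Fin.Properties using (any?; injective⇒≤)
open import Data.Fin.Subset using (Subset; _∈_)
open import Data.Bool using (true)
import Data.Bool.Properties as Bool
open import Data.Vec using (tabulate; lookup)
open import Data.Vec.Properties using ([]=⇒lookup; lookup⇒[]=; lookup∘tabulate)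
open import Data.Product using (Σ; ∃; _×_; _,_; proj₁; proj₂)
open import Data.Sum using (_⊎_; inj₁; inj₂)
open import Data.Empty using (⊥-elim)
open import Function using (_⇔_; mk⇔; Equivalence)
open import Relation.Nullary using (¬_; Dec; yes; no; does; proof; Reflects; invert)
open import Relation.Nullary.Decidable using (_×-dec_; map′; dec-true)
open import Relation.Unary using (Pred; Decidable; _≐_)
open import Relation.Binary using (Rel)
open import Relation.Binary.PropositionalEquality using (_≡_; refl; sym; trans; cong; subst)
open import Relation.Binary.Construct.Closure.ReflexiveTransitive using (Star; ε; _◅_)

module _ {n ℓ} {P : Pred (Fin n) ℓ} (P? : Decidable P) where

  toSubset : Subset n
  toSubset = tabulate (λ x → does (P? x))

  ∈-toSubset : ∀ x → x ∈ toSubset ⇔ P x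
  ∈-toSubset x = mk⇔
    (λ x∈ → invert (subst (Reflects (P x)) (trans (sym lookup-x) ([]=⇒lookup x∈)) (proof (P? x))))
    (λ px → lookup⇒[]= x toSubset (trans lookup-x (dec-true (P? x) px)))
    where
    lookup-x : lookup toSubset x ≡ does (P? x)
    lookup-x = lookup∘tabulate (λ y → does (P? y)) x

module AcyclicStar {n ℓ} {_⟶_ : Rel (Fin n) ℓ}
  (acyclic : ∀ u v → u ⟶ v → ¬ Star _⟶_ v u) where

  length : ∀ {u v} → Star _⟶_ u v → ℕ
  length ε = 0
  length (_ ◅ p) = suc (length p)

  vertex : ∀ {u v} (p : Star _⟶_ u v) → Fin (suc (length p)) → Fin n
  vertex {u} p zero = u
  vertex (_ ◅ p) (suc i) = vertex p i

  prefix : ∀ {u v} (p : Star _⟶_ u v) i → Star _⟶_ u (vertex p i)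
  prefix p zero = ε
  prefix (a ◅ p) (suc i) = a ◅ prefix p i

  vertex-injective : ∀ {u v} (p : Star _⟶_ u v) i j → vertex p i ≡ vertex p j → i ≡ j
  vertex-injective p zero zero _ = refl
  vertex-injective (_◅_ {i = u} {j = w} a p) zero (suc j) eq =
    ⊥-elim (acyclic u w a (subst (Star _⟶_ w) (sym eq) (prefix p j)))
  vertex-injective (_◅_ {i = u} {j = w} a p) (suc i) zero eq =
    ⊥-elim (acyclic u w a (subst (Star _⟶_ w) eq (prefix p i)))
  vertex-injective (_ ◅ p) (suc i) (suc j) eq = cong suc (vertex-injective p i j eq)

  length<n : ∀ {u v} (p : Star _⟶_ u v) → length p < n
  length<n p = injective⇒≤ (λ {i} {j} → vertex-injective p i j)

  data Path≤ : ℕ → Rel (Fin n) ℓ where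
    ε : ∀ {m v} → Path≤ m v v
    _◅_ : ∀ {m u w v} → u ⟶ w → Path≤ m w v → Path≤ (suc m) u v

  Path≤⇒Star : ∀ {m u v} → Path≤ m u v → Star _⟶_ u v
  Path≤⇒Star ε = ε
  Path≤⇒Star (a ◅ p) = a ◅ Path≤⇒Star p

  Star⇒Path≤ : ∀ {u v} (p : Star _⟶_ u v) → Path≤ (length p) u v
  Star⇒Path≤ ε = ε
  Star⇒Path≤ (a ◅ p) = a ◅ Star⇒Path≤ p

  Path≤-mono : ∀ {m m' u v} → m ≤ m' → Path≤ m u v → Path≤ m' u v
  Path≤-mono _ ε = ε
  Path≤-mono (s≤s m≤m') (a ◅ p) = a ◅ Path≤-mono m≤m' p

  module _ (_⟶?_ : ∀ u v → Dec (u ⟶ v)) where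

    path≤? : ∀ m u v → Dec (Path≤ m u v)
    path≤? m u v with u ≟ v
    ... | yes refl = yes ε
    path≤? zero u v | no u≢v = no λ { ε → u≢v refl }
    path≤? (suc m) u v | no u≢v with any? (λ w → (u ⟶? w) ×-dec path≤? m w v)
    ... | yes (w , a , p) = yes (a ◅ p)
    ... | no ¬step = no λ { ε → u≢v refl ; (a ◅ p) → ¬step (_ , a , p) }

    star? : ∀ u v → Dec (Star _⟶_ u v)
    star? u v = map′ Path≤⇒Star (λ p → Path≤-mono (<⇒≤ (length<n p)) (Star⇒Path≤ p)) (path≤? n u v)

    Sink : Pred (Fin n) ℓ
    Sink x = ∀ v → Star _⟶_ x v → v ≡ x

    arc-or-sink : ∀ u → (∃ λ w → u ⟶ w) ⊎ Sink u
    arc-or-sink u with any? (u ⟶?_)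
    ... | yes arc = inj₁ arc
    ... | no ¬arc = inj₂ λ { _ ε → refl ; _ (a ◅ _) → ⊥-elim (¬arc (_ , a)) }

    sink? : Decidable Sink
    sink? x with arc-or-sink x
    ... | inj₁ (w , a) = no λ sink → acyclic x x (subst (x ⟶_) (sink w (a ◅ ε)) a) ε
    ... | inj₂ sink = yes sink

    sink-or-path : ∀ m u → (∃ λ x → Sink x × Star _⟶_ u x) ⊎ (∃ λ v → Σ (Star _⟶_ u v) λ p → length p ≡ m)
    sink-or-path zero u = inj₂ (u , ε , refl)
    sink-or-path (suc m) u with arc-or-sink u
    ... | inj₂ sink = inj₁ (u , sink , ε)
    ... | inj₁ (w , a) with sink-or-path m w
    ...   | inj₁ (x , sink , p) = inj₁ (x , sink , a ◅ p)
    ...   | inj₂ (v , p , eq) = inj₂ (v , a ◅ p , cong suc eq)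

    reaches-sink : ∀ u → ∃ λ x → Sink x × Star _⟶_ u x
    reaches-sink u with sink-or-path n u
    ... | inj₁ reached = reached
    ... | inj₂ (_ , p , eq) = ⊥-elim (<-irrefl eq (length<n p))

module _ {n} (G : Digraph n) where

  LcaIs-resp-≐ : ∀ {Y Z q} → Y ≐ Z → LcaIs G Y q → LcaIs G Z q
  LcaIs-resp-≐ {Y} {Z} (Y⊆Z , Z⊆Y) ((ancestor , minimal) , unique) =
    (ancestor-Z ancestor , λ q' ancestor' → minimal q' (ancestor-Y ancestor')) ,
    λ q' (ancestor' , minimal') → unique q' (ancestor-Y ancestor' , λ q'' a → minimal' q'' (ancestor-Z a))
    where
    ancestor-Z : ∀ {r} → CommonAncestor G Y r → CommonAncestor G Z r
    ancestor-Z a y z = a y (Z⊆Y z)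
    ancestor-Y : ∀ {r} → CommonAncestor G Z r → CommonAncestor G Y r
    ancestor-Y a y y∈ = a y (Y⊆Z y∈)

module Clusters {n} (G : Digraph n) (dag : IsDAG G) where

  open AcyclicStar {_⟶_ = Arc G} dag

  arc? : ∀ u v → Dec (Arc G u v)
  arc? u v = G u v Bool.≟ true

  C? : ∀ v → Decidable (C G v)
  C? v x = sink? arc? x ×-dec star? arc? v x

  C-subset : Fin n → Subset n
  C-subset v = toSubset (C? v)

  C-subset≐C : ∀ v → ⟦ G ⟧ (C-subset v) ≐ C G v
  C-subset≐C v =
    (λ {x} → Equivalence.to (∈-toSubset (C? v) x)) ,
    (λ {x} → Equivalence.from (∈-toSubset (C? v) x))

  C-subset-nonEmpty : ∀ v → NonEmptyLeafSet G (C-subset v)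
  C-subset-nonEmpty v =
    let x , leaf , v⟶*x = reaches-sink arc? v in
    (x , proj₂ (C-subset≐C v) (leaf , v⟶*x)) ,
    λ _ x∈ → proj₁ (proj₁ (C-subset≐C v) x∈)

lemma6 : (n : ℕ) (G : Digraph n) (k : ℕ) → IsDAG G →
    StrongKLcaProperty G k → StrictKLcaProperty G k
lemma6 n G k dag (lca , strong) =
  (λ U U∈Xk → lca U (proj₁ U∈Xk)) ,
  (λ v → let q , lcaC = lca (C-subset v) (C-subset-nonEmpty v) in
         q , LcaIs-resp-≐ G (C-subset≐C v) lcaC) ,
  λ w → let U , U∈Xk , q , lcaU , lcaC = strong (C-subset w) (C-subset-nonEmpty w) in
        U , U∈Xk , q , LcaIs-resp-≐ G (C-subset≐C w) lcaC , lcaU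
  where open Clusters G dag
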